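{- For every finite graph $G$, the branch-depth of its graphic matroid $M(G)$ is at most the tree-depth $\mathrm{td}(G)$.
   Context: The graphic matroid $M(G)$ has the edges of $G$ as elements, a set of edges being independent iff it is acyclic. Depth of a rooted tree: the number of edges of a longest root-to-leaf path. For a rooted tree $T$, $\mathrm{cl}(T)$ is the graph on $V(T)$ with an edge between $u$ and $v$ whenever one is an ancestor of the other. The tree-depth $\mathrm{td}(G)$ is the smallest depth of a rooted tree $T$ with $V(T)=V(G)$ and $G\subseteq\mathrm{cl}(T)$. $\|T\|$ is the number of edges of $T$. A depth-decomposition of a finite matroid $M$ with rank function $r$ is a pair $(T,f)$, $T$ a rooted tree, $f:M\to V(T)$, such that (1) $r(M)=\|T\|$ and (2) $r(X)\le\|T^*(X)\|$ for all $X\subseteq M$, where $T^*(X)$ is the union of the paths from the root to the vertices of $f(X)$. The branch-depth $\mathrm{bd}(M)$ is the smallest depth of a rooted tree $T$ for which some $(T,f)$ is a depth-decomposition of $M$. -}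

module Defs where

open import Data.Nat using (ℕ; zero; suc; _∸_; _≤_)
open import Data.Fin using (Fin; zero; suc; inject₁; fromℕ; _≟_)
open import Data.Fin.Subset using (Subset; _∈_; _⊆_; ∣_∣; ⊤)
open import Data.Vec using (tabulate; lookup)
open import Data.Bool using (Bool; true; false; _∧_; not)
open import Data.List using (upTo; allFin)
open import Data.Bool.ListAction using (any)
open import Data.Product using (Σ; ∃; ∃-syntax; _×_; _,_; proj₁; proj₂)
open import Data.Sum using (_⊎_)
open import Relation.Binary.PropositionalEquality using (_≡_)
open import Relation.Nullary using (¬_)
open import Relation.Nullary.Decidable using (⌊_⌋)
open import Function.Definitions using (Injective)

-- Finite graphs (loops and parallel edges allowed):
-- vertices Fin nV, edges Fin nE, each edge has two (unordered) ends.

record Graph : Set where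
  field
    nV   : ℕ
    nE   : ℕ
    ends : Fin nE → Fin nV × Fin nV
open Graph public

Joins : (G : Graph) → Fin (nE G) → Fin (nV G) → Fin (nV G) → Set
Joins G e u v =
  (proj₁ (ends G e) ≡ u × proj₂ (ends G e) ≡ v) ⊎
  (proj₁ (ends G e) ≡ v × proj₂ (ends G e) ≡ u)

-- A cycle of G all of whose edges lie in F: a closed walk
-- vert 0, edge 0, vert 1, ..., edge len, vert (len+1) = vert 0
-- with (len+1) distinct edges and (len+1) distinct vertices.
record Cycle (G : Graph) (F : Subset (nE G)) : Set where
  field
    len      : ℕ
    edge     : Fin (suc len) → Fin (nE G)
    vert     : Fin (suc (suc len)) → Fin (nV G)
    closed   : vert zero ≡ vert (fromℕ (suc len))
    edge-inj : Injective _≡_ _≡_ edge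
    vert-inj : Injective _≡_ _≡_ (λ i → vert (inject₁ i))
    joins    : ∀ i → Joins G (edge i) (vert (inject₁ i)) (vert (suc i))
    inF      : ∀ i → edge i ∈ F

-- independent sets of the graphic matroid M(G): acyclic edge sets
Acyclic : (G : Graph) → Subset (nE G) → Set
Acyclic G F = ¬ Cycle G F

IsRank : (G : Graph) → Subset (nE G) → ℕ → Set
IsRank G X ρ =
  (Σ (Subset (nE G)) λ F → F ⊆ X × Acyclic G F × ∣ F ∣ ≡ ρ) ×
  (∀ (F : Subset (nE G)) → F ⊆ X → Acyclic G F → ∣ F ∣ ≤ ρ)

-- Rooted trees on vertex set Fin k, given by a parent map; the root is
-- its own parent and every vertex reaches the root by iterating parent.
-- The tree edges are {v , parent v} for v ≠ root.

iter : ∀ {A : Set} → (A → A) → ℕ → A → A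
iter f zero    a = a
iter f (suc n) a = f (iter f n a)

record RootedTree (k : ℕ) : Set where
  field
    root        : Fin k
    parent      : Fin k → Fin k
    parent-root : parent root ≡ root
    reaches     : ∀ v → ∃[ j ] iter parent j v ≡ root
open RootedTree public

‖_‖ : ∀ {k} → RootedTree k → ℕ
‖_‖ {k} T = k ∸ 1

DepthAtMost : ∀ {k} → RootedTree k → ℕ → Set
DepthAtMost T d = ∀ v → iter (parent T) d v ≡ root T

AncestorOrEq : ∀ {k} → RootedTree k → Fin k → Fin k → Set
AncestorOrEq T u v = ∃[ j ] iter (parent T) j v ≡ u

-- boolean version (paths in a tree on k vertices have length < k)
ancᵇ : ∀ {k} → RootedTree k → Fin k → Fin k → Bool
ancᵇ {k} T u v = any (λ j → ⌊ iter (parent T) j v ≟ u ⌋) (upTo k)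

-- ‖T*(X)‖ : the edges of the union of root paths to f(X) are exactly the
-- edges {v , parent v} for non-root v that are ancestor-or-equal of some f(x), x ∈ X.
T*-vertices : ∀ {m k} → RootedTree k → (Fin m → Fin k) → Subset m → Subset k
T*-vertices {m} T f X =
  tabulate λ v → not ⌊ v ≟ root T ⌋ ∧ any (λ x → lookup X x ∧ ancᵇ T v (f x)) (allFin m)

‖T*‖ : ∀ {m k} → RootedTree k → (Fin m → Fin k) → Subset m → ℕ
‖T*‖ T f X = ∣ T*-vertices T f X ∣

IsDepthDecomposition : (G : Graph) {k : ℕ} → RootedTree k → (Fin (nE G) → Fin k) → Set
IsDepthDecomposition G T f =
  IsRank G ⊤ ‖ T ‖ ×
  (∀ (X : Subset (nE G)) (ρ : ℕ) → IsRank G X ρ → ρ ≤ ‖T*‖ T f X)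

BranchDepthAtMost : Graph → ℕ → Set
BranchDepthAtMost G d =
  Σ ℕ λ k → Σ (RootedTree k) λ T → Σ (Fin (nE G) → Fin k) λ f →
    IsDepthDecomposition G T f × DepthAtMost T d

-- G ⊆ cl(T) (ancestry taken reflexively, so loops are harmless)
InClosure : (G : Graph) → RootedTree (nV G) → Set
InClosure G T = ∀ e →
  AncestorOrEq T (proj₁ (ends G e)) (proj₂ (ends G e)) ⊎
  AncestorOrEq T (proj₂ (ends G e)) (proj₁ (ends G e))

TreeDepthAtMost : Graph → ℕ → Set
TreeDepthAtMost G d =
  Σ (RootedTree (nV G)) λ T → InClosure G T × DepthAtMost T d

-- Take a rooted tree T of depth at most d whose closure contains G, and send each edge to its lower end.
-- If G is connected, breadth-first search from the root gives every other vertex an edge down to a vertex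
-- closer to the root; these edges form a spanning tree, so r(M(G)) = |V(G)| − 1 = ‖T‖. Moreover a forest
-- F ⊆ X has at most as many edges as it has ends other than the root, and every such end is an ancestor of
-- the image of an edge of X, hence a non-root vertex of T*(X).
-- If G is disconnected, climbing from a vertex outside the component of the root finds a vertex t whose
-- parent lies in another component. Contracting the tree edge between them keeps the depth at most d,
-- keeps the ends of every edge comparable, and creates no cycle, since it merges two different
-- components. Repeating this, with G drawn on the contracted trees, reaches the connected case.

module Submission where

open import Defs
open import Data.Nat using (ℕ; zero; suc; _+_; _∸_; _≤_; _<_; z≤n; s≤s; _≤?_; _<?_) renaming (_≟_ to _≟ℕ_)
open import Data.Nat.Induction using (<-wellFounded)
open import Induction.WellFounded using (Acc; acc)
open import Data.Nat.Properties hiding (_≟_)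
open import Data.Fin as Fin using (Fin; zero; suc; toℕ; fromℕ; inject₁; punchIn; punchOut; _≟_)
import Data.Fin.Properties as FinP
open import Data.Fin.Subset using (Subset; _∈_; _∉_; _⊆_; ∣_∣; ⊤; ∁; _-_; ⁅_⁆; inside; outside)
import Data.Fin.Subset.Properties as SubP
open import Data.Vec using ([]; _∷_; here; there; tabulate)
import Data.Vec.Properties as VecP
open import Data.Bool using (Bool; true; false; _∨_; if_then_else_) renaming (T to So)
open import Data.Bool.Properties using (T-≡; T-∧; T-∨)
open import Data.List.Membership.Propositional using (lose)
open import Data.List.Membership.Propositional.Properties using (∈-upTo⁺; ∈-allFin)
open import Data.List.Relation.Unary.Any.Properties using (any⁺)
open import Data.Product using (∃; _×_; _,_; proj₁; proj₂)
open import Data.Sum using (_⊎_; inj₁; inj₂; [_,_]′)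
import Data.Sum as Sum
open import Data.Empty using (⊥; ⊥-elim)
open import Data.Maybe using (Maybe; just; nothing)
open import Data.Maybe.Properties using (just-injective; ≡-dec)
open import Function using (_∘_; id; Equivalence)
open import Function.Definitions using (Injective)
open import Relation.Binary.Definitions using (tri<; tri≈; tri>)
open import Relation.Binary.PropositionalEquality
open import Relation.Nullary using (¬_; Dec; yes; no)
open import Relation.Nullary.Decidable using (_⊎-dec_; _×-dec_; _→-dec_; ¬?; T?; ⌊_⌋; toWitness; fromWitness; fromWitnessFalse)

-- Finite sets, sequences and iteration

≤1+n⇒≤n⊎≡1+n : ∀ {j n} → j ≤ suc n → j ≤ n ⊎ j ≡ suc n
≤1+n⇒≤n⊎≡1+n = Sum.map₁ m<1+n⇒m≤n ∘ m≤n⇒m<n∨m≡n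

So-≡ : ∀ {a b} → (So a → So b) → (So b → So a) → a ≡ b
So-≡ {false} {false} _ _ = refl
So-≡ {false} {true}  _ b⇒a = ⊥-elim (b⇒a _)
So-≡ {true}  {false} a⇒b _ = ⊥-elim (a⇒b _)
So-≡ {true}  {true}  _ _ = refl

¬So⇒≡false : ∀ {a} → ¬ So a → a ≡ false
¬So⇒≡false {false} _ = refl
¬So⇒≡false {true} ¬a = ⊥-elim (¬a _)

∈-tabulate⁺ : ∀ {n} (g : Fin n → Bool) {v} → So (g v) → v ∈ tabulate g
∈-tabulate⁺ g {v} gv =
  VecP.lookup⇒[]= v (tabulate g) (trans (VecP.lookup∘tabulate g v) (Equivalence.to T-≡ gv))

∈-tabulate⁻ : ∀ {n} (g : Fin n → Bool) {v} → v ∈ tabulate g → So (g v)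
∈-tabulate⁻ g {v} v∈ =
  Equivalence.from T-≡ (trans (sym (VecP.lookup∘tabulate g v)) (VecP.[]=⇒lookup v∈))

∣p∣≤1+∣p-x∣ : ∀ {n} (p : Subset n) (x : Fin n) → ∣ p ∣ ≤ suc ∣ p - x ∣
∣p∣≤1+∣p-x∣ (inside  ∷ p) zero    = s≤s (≤-reflexive (cong ∣_∣ (sym (SubP.p─⊥≡p p))))
∣p∣≤1+∣p-x∣ (outside ∷ p) zero    = m≤n⇒m≤1+n (≤-reflexive (cong ∣_∣ (sym (SubP.p─⊥≡p p))))
∣p∣≤1+∣p-x∣ (inside  ∷ p) (suc x) = s≤s (∣p∣≤1+∣p-x∣ p x)
∣p∣≤1+∣p-x∣ (outside ∷ p) (suc x) = ∣p∣≤1+∣p-x∣ p x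

x∉p-x : ∀ {n} (p : Subset n) x → x ∉ p - x
x∉p-x (s ∷ p) zero    ()
x∉p-x (s ∷ p) (suc x) (there x∈) = x∉p-x p x x∈

∣∁⁅x⁆∣≡n∸1 : ∀ {n} (x : Fin n) → ∣ ∁ ⁅ x ⁆ ∣ ≡ n ∸ 1
∣∁⁅x⁆∣≡n∸1 {n} x = trans (SubP.∣∁p∣≡n∸∣p∣ ⁅ x ⁆) (cong (n ∸_) (SubP.∣⁅x⁆∣≡1 x))

∈∁⁅⁆⁺ : ∀ {n} {x y : Fin n} → x ≢ y → x ∈ ∁ ⁅ y ⁆
∈∁⁅⁆⁺ x≢y = SubP.x∉p⇒x∈∁p (SubP.x≢y⇒x∉⁅y⁆ x≢y)

∈∁⁅⁆⁻ : ∀ {n} {x y : Fin n} → x ∈ ∁ ⁅ y ⁆ → x ≢ y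
∈∁⁅⁆⁻ x∈ = SubP.x∉⁅y⁆⇒x≢y (SubP.x∈∁p⇒x∉p x∈)

injection⇒∣p∣≤∣q∣ : ∀ {a b} (p : Subset a) (q : Subset b) (h : ∀ x → x ∈ p → Fin b) →
                    (∀ x x∈p → h x x∈p ∈ q) →
                    (∀ x y x∈p y∈p → h x x∈p ≡ h y y∈p → x ≡ y) → ∣ p ∣ ≤ ∣ q ∣
injection⇒∣p∣≤∣q∣ [] q h h∈q h-inj = z≤n
injection⇒∣p∣≤∣q∣ (outside ∷ p) q h h∈q h-inj =
  injection⇒∣p∣≤∣q∣ p q (λ x x∈p → h (suc x) (there x∈p)) (λ x x∈p → h∈q (suc x) (there x∈p))
    (λ x y x∈p y∈p eq → FinP.suc-injective (h-inj _ _ _ _ eq))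
injection⇒∣p∣≤∣q∣ (inside ∷ p) q h h∈q h-inj =
  ≤-trans (s≤s rest) (SubP.x∈p⇒∣p-x∣<∣p∣ (h∈q zero here))
  where
  rest : ∣ p ∣ ≤ ∣ q - h zero here ∣
  rest = injection⇒∣p∣≤∣q∣ p (q - h zero here) (λ x x∈p → h (suc x) (there x∈p))
    (λ x x∈p → SubP.x∈p∧x≢y⇒x∈p-y (h∈q (suc x) (there x∈p)) (λ eq → FinP.0≢1+n (sym (h-inj _ _ _ _ eq))))
    (λ x y x∈p y∈p eq → FinP.suc-injective (h-inj _ _ _ _ eq))

InjectiveUpTo : ∀ {A : Set} → (ℕ → A) → ℕ → Set
InjectiveUpTo X m = ∀ a b → a ≤ m → b ≤ m → X a ≡ X b → a ≡ b

InjectiveUpTo-extend : ∀ {A : Set} (X : ℕ → A) m → InjectiveUpTo X m →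
                       (∀ i → i ≤ m → X i ≢ X (suc m)) → InjectiveUpTo X (suc m)
InjectiveUpTo-extend X m inj fresh a b a≤ b≤ eq with ≤1+n⇒≤n⊎≡1+n a≤ | ≤1+n⇒≤n⊎≡1+n b≤
... | inj₁ a≤m  | inj₁ b≤m  = inj a b a≤m b≤m eq
... | inj₁ a≤m  | inj₂ refl = ⊥-elim (fresh a a≤m eq)
... | inj₂ refl | inj₁ b≤m  = ⊥-elim (fresh b b≤m (sym eq))
... | inj₂ refl | inj₂ refl = refl

InjectiveUpTo⇒≤ : ∀ {n} (X : ℕ → Fin n) m → InjectiveUpTo X m → suc m ≤ n
InjectiveUpTo⇒≤ X m inj = FinP.injective⇒≤ {f = X ∘ toℕ}
  (λ {a} {b} eq → FinP.toℕ-injective (inj (toℕ a) (toℕ b) (FinP.toℕ≤pred[n] a) (FinP.toℕ≤pred[n] b) eq))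

position : ∀ {n} (X : ℕ → Fin n) m → InjectiveUpTo X m → ∀ y → ∃ λ q → ∀ i → i ≤ m → X i ≡ y → i ≡ q
position X m inj y with FinP.any? (λ (l : Fin (suc m)) → X (toℕ l) ≟ y)
... | yes (l , Xl≡y) = toℕ l , λ i i≤m Xi≡y → inj i (toℕ l) i≤m (FinP.toℕ≤pred[n] l) (trans Xi≡y (sym Xl≡y))
... | no  absent     = suc m , λ i i≤m Xi≡y →
  ⊥-elim (absent (Fin.fromℕ< (s≤s i≤m) , trans (cong X (FinP.toℕ-fromℕ< (s≤s i≤m))) Xi≡y))

argmax : (g : ℕ → ℕ) (n : ℕ) → ∃ λ i → i ≤ n × (∀ j → j ≤ n → g j ≤ g i)
argmax g zero = 0 , z≤n , λ { zero z≤n → ≤-refl }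
argmax g (suc n) with argmax g n
... | i , i≤n , i-max with g i ≤? g (suc n)
...   | yes gi≤ = suc n , ≤-refl , λ j j≤ →
  [ (λ j≤n → ≤-trans (i-max j j≤n) gi≤) , (λ { refl → ≤-refl }) ]′ (≤1+n⇒≤n⊎≡1+n j≤)
...   | no  gi≰ = i , m≤n⇒m≤1+n i≤n , λ j j≤ →
  [ i-max j , (λ { refl → <⇒≤ (≰⇒> gi≰) }) ]′ (≤1+n⇒≤n⊎≡1+n j≤)

module _ {P : ℕ → Set} (P? : ∀ n → Dec (P n)) where

  first-below : ∀ n → (∃ λ m → m < n × P m × (∀ j → j < m → ¬ P j)) ⊎ (∀ j → j < n → ¬ P j)
  first-below zero = inj₂ λ _ ()
  first-below (suc n) with first-below n
  ... | inj₁ (m , m<n , pm , minimal) = inj₁ (m , m<n⇒m<1+n m<n , pm , minimal)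
  ... | inj₂ none with P? n
  ...   | yes pn = inj₁ (n , ≤-refl , pn , none)
  ...   | no ¬pn = inj₂ λ j j< → [ none j , (λ { refl → ¬pn }) ]′ (m<1+n⇒m<n∨m≡n j<)

  first : ∀ n → P n → ∃ λ m → P m × (∀ j → j < m → ¬ P j)
  first n pn with first-below (suc n)
  ... | inj₁ (m , _ , pm , minimal) = m , pm , minimal
  ... | inj₂ none = ⊥-elim (none n ≤-refl pn)

-- A cyclic sequence b 0, …, b m (b m being followed by b 0) can change at most at position q.
module _ {A : Set} (b : ℕ → A) (m q : ℕ) (step : ∀ j → j < m → suc j ≢ q → b (suc j) ≡ b j) where

  private
    forward : ∀ j → j ≤ m → (∀ i → i < j → suc i ≢ q) → b j ≡ b 0
    forward zero    _   _     = refl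
    forward (suc j) j<m avoid =
      trans (step j j<m (avoid j ≤-refl)) (forward j (<⇒≤ j<m) λ i i<j → avoid i (m<n⇒m<1+n i<j))

    backward : ∀ g j → j + g ≡ m → (∀ i → j ≤ i → suc i ≢ q) → b j ≡ b m
    backward zero    j j+0≡m _     = cong b (trans (sym (+-identityʳ j)) j+0≡m)
    backward (suc g) j j+g≡m avoid =
      trans (sym (step j j<m (avoid j ≤-refl)))
            (backward g (suc j) (trans (sym (+-suc j g)) j+g≡m) λ i j<i → avoid i (<⇒≤ j<i))
      where
      j<m : j < m
      j<m = subst (j <_) j+g≡m (subst (j <_) (sym (+-suc j g)) (s≤s (m≤m+n j g)))

  constant-around : (q ≢ 0 → b m ≡ b 0) → ∀ j → j ≤ m → b j ≡ b 0
  constant-around wrap j j≤m with j <? q | q ≟ℕ 0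
  ... | yes j<q | _        = forward j j≤m λ i i<j eq → <-irrefl eq (≤-<-trans i<j j<q)
  ... | no  _   | yes refl = forward j j≤m λ i _ ()
  ... | no  j≮q | no q≢0   = trans (backward (m ∸ j) j (m+[n∸m]≡n j≤m) avoid) (wrap q≢0)
    where
    avoid : ∀ i → j ≤ i → suc i ≢ q
    avoid i j≤i eq = 1+n≰n (≤-trans (≤-reflexive eq) (≤-trans (≮⇒≥ j≮q) j≤i))

iter-+ : ∀ {A : Set} (f : A → A) a b x → iter f (a + b) x ≡ iter f a (iter f b x)
iter-+ f zero    b x = refl
iter-+ f (suc a) b x = cong f (iter-+ f a b x)

iter-fixed : ∀ {A : Set} (f : A → A) {y} → f y ≡ y → ∀ j → iter f j y ≡ y
iter-fixed f fy≡y zero    = refl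
iter-fixed f fy≡y (suc j) = trans (cong f (iter-fixed f fy≡y j)) fy≡y

iter-beyond : ∀ {A : Set} (f : A → A) {x y} j₀ → iter f j₀ x ≡ y → f y ≡ y →
              ∀ j → j₀ ≤ j → iter f j x ≡ y
iter-beyond f {x} j₀ reached fy≡y j j₀≤j = begin
  iter f j x                    ≡⟨ cong (λ n → iter f n x) (sym (m∸n+n≡m j₀≤j)) ⟩
  iter f (j ∸ j₀ + j₀) x        ≡⟨ iter-+ f (j ∸ j₀) j₀ x ⟩
  iter f (j ∸ j₀) (iter f j₀ x) ≡⟨ cong (iter f (j ∸ j₀)) reached ⟩
  iter f (j ∸ j₀) _             ≡⟨ iter-fixed f fy≡y (j ∸ j₀) ⟩
  _                             ∎
  where open ≡-Reasoning

-- The orbit of x under f is eventually periodic with a period found by pigeonhole among its first k+1 points.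
iter-shortcut : ∀ {k} (f : Fin k → Fin k) x j → ∃ λ j′ → j′ < k × iter f j′ x ≡ iter f j x
iter-shortcut {k} f x j with FinP.pigeonhole (n<1+n k) (λ (i : Fin (suc k)) → iter f (toℕ i) x)
... | a , b , a<b , orbit-a≡b = shorten j (<-wellFounded j)
  where
  shorten : ∀ j → Acc _<_ j → ∃ λ j′ → j′ < k × iter f j′ x ≡ iter f j x
  shorten j (acc rec) with j <? k
  ... | yes j<k = j , j<k , refl
  ... | no  j≮k = let (j′ , j′<k , eq) = shorten (j ∸ toℕ b + toℕ a) (rec shorter) in j′ , j′<k , trans eq skip
    where
    open ≡-Reasoning
    b≤j : toℕ b ≤ j
    b≤j = ≤-trans (FinP.toℕ≤pred[n] b) (≮⇒≥ j≮k)
    shorter : j ∸ toℕ b + toℕ a < j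
    shorter = subst (j ∸ toℕ b + toℕ a <_) (m∸n+n≡m b≤j) (+-monoʳ-< (j ∸ toℕ b) a<b)
    skip : iter f (j ∸ toℕ b + toℕ a) x ≡ iter f j x
    skip = begin
      iter f (j ∸ toℕ b + toℕ a) x           ≡⟨ iter-+ f (j ∸ toℕ b) (toℕ a) x ⟩
      iter f (j ∸ toℕ b) (iter f (toℕ a) x)  ≡⟨ cong (iter f (j ∸ toℕ b)) orbit-a≡b ⟩
      iter f (j ∸ toℕ b) (iter f (toℕ b) x)  ≡⟨ iter-+ f (j ∸ toℕ b) (toℕ b) x ⟨
      iter f (j ∸ toℕ b + toℕ b) x           ≡⟨ cong (λ n → iter f n x) (m∸n+n≡m b≤j) ⟩
      iter f j x                             ∎

crossing : ∀ {A : Set} (f : A → A) (P : A → Bool) x j → P x ≡ false → P (iter f j x) ≡ true →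
           ∃ λ t → P t ≡ false × P (f t) ≡ true
crossing f P x zero    Px≡false Px≡true with trans (sym Px≡false) Px≡true
... | ()
crossing f P x (suc j) Px≡false Pfx≡true with P (iter f j x) in eq
... | true  = crossing f P x j Px≡false eq
... | false = iter f j x , eq , Pfx≡true

-- Cycles and forests

Joins-sym : ∀ G e {u v} → Joins G e u v → Joins G e v u
Joins-sym G e (inj₁ (a , b)) = inj₂ (a , b)
Joins-sym G e (inj₂ (a , b)) = inj₁ (a , b)

Joins-ends : ∀ G e {u v u′ v′} → Joins G e u v → Joins G e u′ v′ →
             (u ≡ u′ × v ≡ v′) ⊎ (u ≡ v′ × v ≡ u′)
Joins-ends G e (inj₁ (a , b)) (inj₁ (a′ , b′)) = inj₁ (trans (sym a) a′ , trans (sym b) b′)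
Joins-ends G e (inj₁ (a , b)) (inj₂ (a′ , b′)) = inj₂ (trans (sym a) a′ , trans (sym b) b′)
Joins-ends G e (inj₂ (a , b)) (inj₁ (a′ , b′)) = inj₂ (trans (sym b) b′ , trans (sym a) a′)
Joins-ends G e (inj₂ (a , b)) (inj₂ (a′ , b′)) = inj₁ (trans (sym b) b′ , trans (sym a) a′)

Incident : (G : Graph) → Fin (nE G) → Fin (nV G) → Set
Incident G e v = proj₁ (ends G e) ≡ v ⊎ proj₂ (ends G e) ≡ v

Incident? : ∀ G e v → Dec (Incident G e v)
Incident? G e v = (proj₁ (ends G e) ≟ v) ⊎-dec (proj₂ (ends G e) ≟ v)

Joins⇒Incidentʳ : ∀ G {e u v} → Joins G e u v → Incident G e v
Joins⇒Incidentʳ G (inj₁ (_ , b)) = inj₂ b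
Joins⇒Incidentʳ G (inj₂ (a , _)) = inj₁ a

otherEnd : ∀ G → Fin (nE G) → Fin (nV G) → Fin (nV G)
otherEnd G e v with proj₁ (ends G e) ≟ v
... | yes _ = proj₂ (ends G e)
... | no  _ = proj₁ (ends G e)

Joins-otherEnd : ∀ G e v → Incident G e v → Joins G e v (otherEnd G e v)
Joins-otherEnd G e v inc with proj₁ (ends G e) ≟ v | inc
... | yes a | _      = inj₁ (a , refl)
... | no ¬a | inj₁ a = ⊥-elim (¬a a)
... | no _  | inj₂ b = inj₂ (refl , b)

mapVertices : (G : Graph) {k : ℕ} → (Fin (nV G) → Fin k) → Graph
mapVertices G {k} φ = record
  { nV = k ; nE = nE G ; ends = λ e → φ (proj₁ (ends G e)) , φ (proj₂ (ends G e)) }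

Joins-map : ∀ G {k} (φ : Fin (nV G) → Fin k) {e u w} →
            Joins G e u w → Joins (mapVertices G φ) e (φ u) (φ w)
Joins-map G φ (inj₁ (a , b)) = inj₁ (cong φ a , cong φ b)
Joins-map G φ (inj₂ (a , b)) = inj₂ (cong φ a , cong φ b)

Joins-map-∘⁻ : ∀ G {k l} (φ : Fin (nV G) → Fin k) (ψ : Fin k → Fin l) {e u v} →
               Joins (mapVertices G (ψ ∘ φ)) e u v →
               ∃ λ x → ∃ λ y → Joins (mapVertices G φ) e x y × ψ x ≡ u × ψ y ≡ v
Joins-map-∘⁻ G φ ψ (inj₁ (a , b)) = _ , _ , inj₁ (refl , refl) , a , b
Joins-map-∘⁻ G φ ψ (inj₂ (a , b)) = _ , _ , inj₂ (refl , refl) , b , a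

-- Cycles with positions in ℕ rather than in Fin, constrained only on [0, len].
record Cycleℕ (G : Graph) (F : Subset (nE G)) : Set where
  field
    len      : ℕ
    edge     : ℕ → Fin (nE G)
    vert     : ℕ → Fin (nV G)
    closed   : vert 0 ≡ vert (suc len)
    edge-inj : InjectiveUpTo edge len
    vert-inj : InjectiveUpTo vert len
    joins    : ∀ i → i ≤ len → Joins G (edge i) (vert i) (vert (suc i))
    inF      : ∀ i → i ≤ len → edge i ∈ F

Cycleℕ-mono : ∀ {G F F′} → F ⊆ F′ → Cycleℕ G F → Cycleℕ G F′
Cycleℕ-mono F⊆F′ c = record { Cycleℕ c ; inF = λ i i≤ → F⊆F′ (Cycleℕ.inF c i i≤) }

clamp : (m : ℕ) → ℕ → Fin (suc m)
clamp zero    n       = zero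
clamp (suc m) zero    = zero
clamp (suc m) (suc n) = suc (clamp m n)

toℕ-clamp : ∀ m n → n ≤ m → toℕ (clamp m n) ≡ n
toℕ-clamp zero    zero    _         = refl
toℕ-clamp (suc m) zero    _         = refl
toℕ-clamp (suc m) (suc n) (s≤s n≤m) = cong suc (toℕ-clamp m n n≤m)

clamp-injective : ∀ m a b → a ≤ m → b ≤ m → clamp m a ≡ clamp m b → a ≡ b
clamp-injective m a b a≤m b≤m eq =
  trans (sym (toℕ-clamp m a a≤m)) (trans (cong toℕ eq) (toℕ-clamp m b b≤m))

clamp-fromℕ : ∀ m → clamp m m ≡ fromℕ m
clamp-fromℕ zero    = refl
clamp-fromℕ (suc m) = cong suc (clamp-fromℕ m)

inject₁-clamp : ∀ m n → n ≤ m → inject₁ (clamp m n) ≡ clamp (suc m) n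
inject₁-clamp zero    zero    _         = refl
inject₁-clamp (suc m) zero    _         = refl
inject₁-clamp (suc m) (suc n) (s≤s n≤m) = cong suc (inject₁-clamp m n n≤m)

Cycle⇒Cycleℕ : ∀ {G F} → Cycle G F → Cycleℕ G F
Cycle⇒Cycleℕ {G} c = record
  { len      = len
  ; edge     = edge ∘ clamp len
  ; vert     = vert ∘ clamp (suc len)
  ; closed   = trans closed (cong vert (sym (clamp-fromℕ (suc len))))
  ; edge-inj = λ a b a≤ b≤ eq → clamp-injective len a b a≤ b≤ (edge-inj eq)
  ; vert-inj = λ a b a≤ b≤ eq → clamp-injective len a b a≤ b≤
                 (vert-inj (trans (cong vert (inject₁-clamp len a a≤))
                           (trans eq (cong vert (sym (inject₁-clamp len b b≤))))))
  ; joins    = λ i i≤ → subst (λ z → Joins G (edge (clamp len i)) (vert z) (vert (suc (clamp len i))))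
                          (inject₁-clamp len i i≤) (joins (clamp len i))
  ; inF      = λ i _ → inF (clamp len i)
  }
  where open Cycle c

Cycleℕ⇒Cycle : ∀ {G F} → Cycleℕ G F → Cycle G F
Cycleℕ⇒Cycle {G} c = record
  { len      = len
  ; edge     = edge ∘ toℕ
  ; vert     = vert ∘ toℕ
  ; closed   = trans closed (cong vert (sym (FinP.toℕ-fromℕ (suc len))))
  ; edge-inj = λ {i} {j} eq → FinP.toℕ-injective (edge-inj _ _ (≤len i) (≤len j) eq)
  ; vert-inj = λ {i} {j} eq → FinP.toℕ-injective (vert-inj _ _ (≤len i) (≤len j)
                 (trans (cong vert (sym (FinP.toℕ-inject₁ i))) (trans eq (cong vert (FinP.toℕ-inject₁ j)))))
  ; joins    = λ i → subst (λ z → Joins G (edge (toℕ i)) (vert z) (vert (suc (toℕ i))))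
                       (sym (FinP.toℕ-inject₁ i)) (joins (toℕ i) (≤len i))
  ; inF      = λ i → inF (toℕ i) (≤len i)
  }
  where
  open Cycleℕ c
  ≤len : (i : Fin (suc len)) → toℕ i ≤ len
  ≤len = FinP.toℕ≤pred[n]

-- At a vertex of maximal potential both cycle edges go downhill, so both would be its designated edge.
descent⇒noCycle : ∀ G F (π : Fin (nV G) → ℕ) (key : Fin (nV G) → Maybe (Fin (nE G))) →
                  (∀ e u w → e ∈ F → Joins G e u w → π w ≤ π u → π w < π u × key u ≡ just e) →
                  ¬ Cycleℕ G F
descent⇒noCycle G F π key descent c = at-top (argmax (π ∘ vert) len)
  where
  open Cycleℕ c
  Top : ℕ → Set
  Top i = ∀ j → j ≤ len → π (vert j) ≤ π (vert i)

  downhill : ∀ j {u w} → j ≤ len → Joins G (edge j) u w → π w ≤ π u → π w < π u × key u ≡ just (edge j)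
  downhill j j≤ = descent _ _ _ (inF j j≤)

  backwards : ∀ j → j ≤ len → Joins G (edge j) (vert (suc j)) (vert j)
  backwards j j≤ = Joins-sym G (edge j) (joins j j≤)

  incoming : ∀ i → i ≤ len → Top i → π (vert (suc i)) < π (vert i) × key (vert i) ≡ just (edge i) → ⊥
  incoming zero _ top (down , key₀) = <-irrefl (cong π vert₁≡vert₀) down
    where
    wrap : Joins G (edge len) (vert 0) (vert len)
    wrap = subst (λ z → Joins G (edge len) z (vert len)) (sym closed) (backwards len ≤-refl)
    len≡0 : len ≡ 0
    len≡0 = edge-inj len 0 ≤-refl z≤n
              (just-injective (trans (sym (proj₂ (downhill len ≤-refl wrap (top len ≤-refl)))) key₀))
    vert₁≡vert₀ : vert 1 ≡ vert 0
    vert₁≡vert₀ = trans (cong (vert ∘ suc) (sym len≡0)) (sym closed)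
  incoming (suc i) i<len top (_ , keyᵢ) = 1+n≢n (sym (edge-inj i (suc i) i≤len i<len (just-injective key≡)))
    where
    i≤len : i ≤ len
    i≤len = ≤-trans (n≤1+n i) i<len
    key≡ : just (edge i) ≡ just (edge (suc i))
    key≡ = trans (sym (proj₂ (downhill i i≤len (backwards i i≤len) (top i i≤len)))) keyᵢ

  at-top : (∃ λ i → i ≤ len × Top i) → ⊥
  at-top (i , i≤len , top) = incoming i i≤len top (downhill i i≤len (joins i i≤len) next≤)
    where
    next≤ : π (vert (suc i)) ≤ π (vert i)
    next≤ with suc i ≤? len
    ... | yes i<len = top (suc i) i<len
    ... | no  i≮len rewrite ≤-antisym i≤len (m<1+n⇒m≤n (≰⇒> i≮len)) | sym closed = top 0 z≤n

record Trail (G : Graph) (F : Subset (nE G)) (X : ℕ → Fin (nV G)) (E : ℕ → Fin (nE G)) (m : ℕ) : Set where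
  field
    joins            : ∀ j → j ≤ m → Joins G (E j) (X j) (X (suc j))
    inF              : ∀ j → j ≤ m → E j ∈ F
    non-backtracking : ∀ j → suc j ≤ m → E (suc j) ≢ E j
    distinct         : InjectiveUpTo X m

module _ {G F X E m} (tr : Trail G F X E m) where
  open Trail tr

  -- A repeated edge would have to be traversed backwards right after itself.
  Trail-edge-distinct : InjectiveUpTo E m
  Trail-edge-distinct α β α≤ β≤ eq
    with Joins-ends G (E α) (joins α α≤) (subst (λ e → Joins G e (X β) (X (suc β))) (sym eq) (joins β β≤))
  ... | inj₁ (Xα≡Xβ , _) = distinct α β α≤ β≤ Xα≡Xβ
  ... | inj₂ (Xα≡Xβ′ , Xα′≡Xβ) with suc β ≤? m
  ...   | yes β<m = ⊥-elim (non-backtracking β β<m (trans (cong E (sym (distinct α (suc β) α≤ β<m Xα≡Xβ′))) eq))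
  ...   | no  β≮m with suc α ≤? m
  ...     | yes α<m = ⊥-elim (non-backtracking α α<m
                        (trans (cong E (trans (distinct (suc α) m α<m ≤-refl (trans Xα′≡Xβ (cong X β≡m))) (sym β≡m)))
                               (sym eq)))
    where β≡m = ≤-antisym β≤ (m<1+n⇒m≤n (≰⇒> β≮m))
  ...     | no  α≮m = trans (≤-antisym α≤ (m<1+n⇒m≤n (≰⇒> α≮m))) (sym (≤-antisym β≤ (m<1+n⇒m≤n (≰⇒> β≮m))))

  Trail⇒Cycleℕ : ∀ i → i ≤ m → X (suc m) ≡ X i → Cycleℕ G F
  Trail⇒Cycleℕ i i≤m returns = record
    { len      = m ∸ i
    ; edge     = λ j → E (i + j)
    ; vert     = λ j → X (i + j)
    ; closed   = trans (cong X (+-identityʳ i))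
                   (trans (sym returns) (cong X (sym (trans (+-suc i (m ∸ i)) (cong suc (m+[n∸m]≡n i≤m))))))
    ; edge-inj = λ a b a≤ b≤ eq → +-cancelˡ-≡ i a b (Trail-edge-distinct (i + a) (i + b) (shift a a≤) (shift b b≤) eq)
    ; vert-inj = λ a b a≤ b≤ eq → +-cancelˡ-≡ i a b (distinct (i + a) (i + b) (shift a a≤) (shift b b≤) eq)
    ; joins    = λ j j≤ → subst (Joins G (E (i + j)) (X (i + j)) ∘ X) (sym (+-suc i j)) (joins (i + j) (shift j j≤))
    ; inF      = λ j j≤ → inF (i + j) (shift j j≤)
    }
    where
    shift : ∀ j → j ≤ m ∸ i → i + j ≤ m
    shift j j≤ = subst (i + j ≤_) (m+[n∸m]≡n i≤m) (+-monoʳ-≤ i j≤)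

IsLeaf : ∀ G (F : Subset (nE G)) → Fin (nV G) → Fin (nE G) → Set
IsLeaf G F ℓ e = e ∈ F × Incident G e ℓ × (∀ e′ → e′ ∈ F → Incident G e′ ℓ → e′ ≡ e)

LeafOtherThan : ∀ G → Subset (nE G) → Fin (nV G) → Set
LeafOtherThan G F x = ∃ λ ℓ → ∃ λ e → ℓ ≢ x × IsLeaf G F ℓ e

-- Walk from x₀ along e₀, always leaving by an edge other than the arriving one, until stuck.
module Walk (G : Graph) (F : Subset (nE G)) (x₀ : Fin (nV G)) (e₀ : Fin (nE G))
            (e₀∈F : e₀ ∈ F) (x₀∈e₀ : Incident G e₀ x₀) where

  Continuation : Fin (nV G) → Fin (nE G) → Set
  Continuation v e = ∃ λ e′ → e′ ∈ F × e′ ≢ e × Incident G e′ v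

  continuation? : ∀ v e → Dec (Continuation v e)
  continuation? v e = FinP.any? λ e′ → (e′ SubP.∈? F) ×-dec ¬? (e′ ≟ e) ×-dec Incident? G e′ v

  step : ∀ v e → Dec (Continuation v e) → Fin (nV G) × Fin (nE G)
  step v e (yes (e′ , _)) = otherEnd G e′ v , e′
  step v e (no _)         = v , e

  step-continues : ∀ v e (d : Dec (Continuation v e)) → Continuation v e →
                   Joins G (proj₂ (step v e d)) v (proj₁ (step v e d)) ×
                   proj₂ (step v e d) ∈ F × proj₂ (step v e d) ≢ e
  step-continues v e (yes (e′ , e′∈F , e′≢e , v∈e′)) _ = Joins-otherEnd G e′ v v∈e′ , e′∈F , e′≢e
  step-continues v e (no ¬c) c = ⊥-elim (¬c c)

  -- the vertex reached after edge n, and edge n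
  arrival : ℕ → Fin (nV G) × Fin (nE G)
  arrival zero    = otherEnd G e₀ x₀ , e₀
  arrival (suc n) = step (proj₁ (arrival n)) (proj₂ (arrival n))
                         (continuation? (proj₁ (arrival n)) (proj₂ (arrival n)))

  X : ℕ → Fin (nV G)
  X zero    = x₀
  X (suc n) = proj₁ (arrival n)

  E : ℕ → Fin (nE G)
  E n = proj₂ (arrival n)

  extend : ∀ {m} → Trail G F X E m → (∀ i → i ≤ m → X i ≢ X (suc m)) →
           Continuation (X (suc m)) (E m) → Trail G F X E (suc m)
  extend {m} tr fresh c = record
    { joins            = λ j j≤ → [ Trail.joins tr j , (λ { refl → proj₁ next }) ]′ (≤1+n⇒≤n⊎≡1+n j≤)
    ; inF              = λ j j≤ → [ Trail.inF tr j , (λ { refl → proj₁ (proj₂ next) }) ]′ (≤1+n⇒≤n⊎≡1+n j≤)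
    ; non-backtracking = λ j j< → [ Trail.non-backtracking tr j , (λ { refl → proj₂ (proj₂ next) }) ]′
                                    (≤1+n⇒≤n⊎≡1+n j<)
    ; distinct         = InjectiveUpTo-extend X m (Trail.distinct tr) fresh
    }
    where next = step-continues (X (suc m)) (E m) (continuation? (X (suc m)) (E m)) c

  explore : ∀ f m → f + m ≡ nV G → Trail G F X E m → Cycleℕ G F ⊎ LeafOtherThan G F x₀
  explore zero m m≡ tr =
    ⊥-elim (1+n≰n (subst (suc m ≤_) (sym m≡) (InjectiveUpTo⇒≤ X m (Trail.distinct tr))))
  explore (suc f) m f+m≡ tr with FinP.any? (λ (i : Fin (suc m)) → X (toℕ i) ≟ X (suc m))
  ... | yes (i , Xi≡) = inj₁ (Trail⇒Cycleℕ tr (toℕ i) (FinP.toℕ≤pred[n] i) (sym Xi≡))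
  ... | no repeated with continuation? (X (suc m)) (E m)
  ...   | yes c = explore f (suc m) (trans (+-suc f m) f+m≡) (extend tr fresh c)
    where
    fresh : ∀ i → i ≤ m → X i ≢ X (suc m)
    fresh i i≤ eq = repeated (Fin.fromℕ< (s≤s i≤) , trans (cong X (FinP.toℕ-fromℕ< (s≤s i≤))) eq)
  ...   | no stuck = inj₂ (X (suc m) , E m , ≢x₀ , Trail.inF tr m ≤-refl ,
                           Joins⇒Incidentʳ G (Trail.joins tr m ≤-refl) , only)
    where
    ≢x₀ : X (suc m) ≢ x₀
    ≢x₀ eq = repeated (zero , sym eq)
    only : ∀ e′ → e′ ∈ F → Incident G e′ (X (suc m)) → e′ ≡ E m
    only e′ e′∈F inc with e′ ≟ E m
    ... | yes eq = eq
    ... | no  ne = ⊥-elim (stuck (e′ , e′∈F , ne , inc))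

  walk : Cycleℕ G F ⊎ LeafOtherThan G F x₀
  walk = explore (nV G) 0 (+-identityʳ _) record
    { joins            = λ { zero _ → Joins-otherEnd G e₀ x₀ x₀∈e₀ }
    ; inF              = λ { zero _ → e₀∈F }
    ; non-backtracking = λ _ ()
    ; distinct         = λ { zero zero _ _ _ → refl }
    }

leafOtherThan : ∀ G F r e → e ∈ F → ¬ Cycleℕ G F → LeafOtherThan G F r
leafOtherThan G F r e e∈F acyclic with FinP.any? (λ e′ → (e′ SubP.∈? F) ×-dec Incident? G e′ r)
... | yes (e′ , e′∈F , r∈e′) = [ ⊥-elim ∘ acyclic , id ]′ (Walk.walk G F r e′ e′∈F r∈e′)
... | no  r∉F with Walk.walk G F (proj₁ (ends G e)) e e∈F (inj₁ refl)
...   | inj₁ c = ⊥-elim (acyclic c)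
...   | inj₂ (ℓ , e′ , _ , leaf@(e′∈F , ℓ∈e′ , _)) = ℓ , e′ , (λ { refl → r∉F (e′ , e′∈F , ℓ∈e′) }) , leaf

endsExcept : ∀ G → Fin (nV G) → Subset (nE G) → Subset (nV G)
endsExcept G r F = tabulate λ v →
  ⌊ ¬? (v ≟ r) ×-dec FinP.any? (λ e → (e SubP.∈? F) ×-dec Incident? G e v) ⌋

∈endsExcept⁺ : ∀ G r F {v e} → v ≢ r → e ∈ F → Incident G e v → v ∈ endsExcept G r F
∈endsExcept⁺ G r F v≢r e∈F v∈e = ∈-tabulate⁺ _ (fromWitness (v≢r , _ , e∈F , v∈e))

∈endsExcept⁻ : ∀ G r F {v} → v ∈ endsExcept G r F → v ≢ r × ∃ λ e → e ∈ F × Incident G e v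
∈endsExcept⁻ G r F v∈ = toWitness (∈-tabulate⁻ _ v∈)

-- Deleting a leaf other than r removes one edge and one end.
forest-bound : ∀ G r F → ¬ Cycleℕ G F → ∣ F ∣ ≤ ∣ endsExcept G r F ∣
forest-bound G r F = bound ∣ F ∣ F ≤-refl
  where
  bound : ∀ m F → ∣ F ∣ ≤ m → ¬ Cycleℕ G F → ∣ F ∣ ≤ ∣ endsExcept G r F ∣
  bound zero    F ∣F∣≤0 _ = ≤-trans ∣F∣≤0 z≤n
  bound (suc m) F ∣F∣≤ acyclic with SubP.nonempty? F
  ... | no  empty = ≤-trans (≤-reflexive (trans (cong ∣_∣ (SubP.Empty-unique empty)) (SubP.∣⊥∣≡0 (nE G)))) z≤n
  ... | yes (e₀ , e₀∈F) with leafOtherThan G F r e₀ e₀∈F acyclic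
  ...   | ℓ , e , ℓ≢r , e∈F , ℓ∈e , only = begin
    ∣ F ∣                            ≤⟨ ∣p∣≤1+∣p-x∣ F e ⟩
    suc ∣ F - e ∣                    ≤⟨ s≤s (bound m (F - e) ∣F-e∣≤m (acyclic ∘ Cycleℕ-mono F-e⊆F)) ⟩
    suc ∣ endsExcept G r (F - e) ∣   ≤⟨ s≤s (SubP.p⊆q⇒∣p∣≤∣q∣ ends⊆) ⟩
    suc ∣ endsExcept G r F - ℓ ∣     ≤⟨ SubP.x∈p⇒∣p-x∣<∣p∣ (∈endsExcept⁺ G r F ℓ≢r e∈F ℓ∈e) ⟩
    ∣ endsExcept G r F ∣             ∎
    where
    open ≤-Reasoning
    F-e⊆F : F - e ⊆ F
    F-e⊆F = SubP.p─q⊆p F ⁅ e ⁆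
    ∣F-e∣≤m : ∣ F - e ∣ ≤ m
    ∣F-e∣≤m = ≤-pred (≤-trans (SubP.x∈p⇒∣p-x∣<∣p∣ e∈F) ∣F∣≤)
    ends⊆ : endsExcept G r (F - e) ⊆ endsExcept G r F - ℓ
    ends⊆ v∈ with ∈endsExcept⁻ G r (F - e) v∈
    ... | v≢r , e′ , e′∈F-e , v∈e′ = SubP.x∈p∧x≢y⇒x∈p-y (∈endsExcept⁺ G r F v≢r (F-e⊆F e′∈F-e) v∈e′) v≢ℓ
      where
      v≢ℓ : _ ≢ ℓ
      v≢ℓ refl = x∉p-x F e (subst (_∈ F - e) (only e′ (F-e⊆F e′∈F-e) v∈e′) e′∈F-e)

-- Rooted trees, breadth-first search and contraction

AncestorOrEq⇒ancᵇ : ∀ {k} (T : RootedTree k) {u w} → AncestorOrEq T u w → So (ancᵇ T u w)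
AncestorOrEq⇒ancᵇ T {w = w} (j , reached) with iter-shortcut (parent T) w j
... | j′ , j′<k , eq = any⁺ _ (lose (∈-upTo⁺ j′<k) (fromWitness (trans eq reached)))

∈T*-vertices⁺ : ∀ {m k} (T : RootedTree k) (f : Fin m → Fin k) {X v x} →
                v ≢ root T → x ∈ X → AncestorOrEq T v (f x) → v ∈ T*-vertices T f X
∈T*-vertices⁺ T f {x = x} v≢r x∈X v≤fx = ∈-tabulate⁺ _ (Equivalence.from T-∧
  (fromWitnessFalse v≢r , any⁺ _ (lose (∈-allFin x)
    (Equivalence.from T-∧ (Equivalence.from T-≡ (VecP.[]=⇒lookup x∈X) , AncestorOrEq⇒ancᵇ T v≤fx)))))

Comparable : ∀ {k} → RootedTree k → Fin k → Fin k → Set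
Comparable T u w = AncestorOrEq T u w ⊎ AncestorOrEq T w u

lower : ∀ {k} (T : RootedTree k) {u w} → Comparable T u w → Fin k
lower T {w = w} (inj₁ _) = w
lower T {u = u} (inj₂ _) = u

lower-below : ∀ {k} (T : RootedTree k) {u w} (c : Comparable T u w) →
              AncestorOrEq T u (lower T c) × AncestorOrEq T w (lower T c)
lower-below T (inj₁ u≤w) = u≤w , (0 , refl)
lower-below T (inj₂ w≤u) = (0 , refl) , w≤u

record Descent (H : Graph) (r : Fin (nV H)) : Set where
  field
    height : Fin (nV H) → ℕ
    down   : ∀ v → v ≢ r → ∃ λ e → ∃ λ w → Joins H e v w × height w < height v

-- a union of components of H containing r but not all of H
record Cut (H : Graph) (r : Fin (nV H)) : Set where
  field
    side           : Fin (nV H) → Bool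
    root-side      : side r ≡ true
    edge-side      : ∀ e → side (proj₁ (ends H e)) ≡ side (proj₂ (ends H e))
    outside-vertex : ∃ λ v → side v ≡ false

module BreadthFirst (H : Graph) (r : Fin (nV H)) where

  Adj : (Fin (nV H) → Bool) → Fin (nE H) → Fin (nV H) → Set
  Adj S e v = (proj₁ (ends H e) ≡ v × So (S (proj₂ (ends H e)))) ⊎
              (proj₂ (ends H e) ≡ v × So (S (proj₁ (ends H e))))

  Adj? : ∀ S e v → Dec (Adj S e v)
  Adj? S e v = ((proj₁ (ends H e) ≟ v) ×-dec T? (S (proj₂ (ends H e)))) ⊎-dec
               ((proj₂ (ends H e) ≟ v) ×-dec T? (S (proj₁ (ends H e))))

  Adj⇒Joins : ∀ {S e v} → Adj S e v → ∃ λ w → Joins H e v w × So (S w)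
  Adj⇒Joins (inj₁ (a , Sw)) = _ , inj₁ (a , refl) , Sw
  Adj⇒Joins (inj₂ (b , Sw)) = _ , inj₂ (refl , b) , Sw

  Near : ℕ → Fin (nV H) → Bool
  Near zero    v = ⌊ v ≟ r ⌋
  Near (suc i) v = Near i v ∨ ⌊ FinP.any? (λ e → Adj? (Near i) e v) ⌋

  Near-suc⁺ : ∀ i {v} → So (Near i v) → So (Near (suc i) v)
  Near-suc⁺ i near = Equivalence.from T-∨ (inj₁ near)

  Near-mono : ∀ {i j v} → i ≤ j → So (Near i v) → So (Near j v)
  Near-mono {j = zero} z≤n near = near
  Near-mono {i} {suc j} i≤ near with ≤1+n⇒≤n⊎≡1+n i≤
  ... | inj₁ i≤j  = Near-suc⁺ j (Near-mono i≤j near)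
  ... | inj₂ refl = near

  Near-adj : ∀ i {e v} → Adj (Near i) e v → So (Near (suc i) v)
  Near-adj i {e} {v} a =
    Equivalence.from T-∨ (inj₂ (fromWitness {a? = FinP.any? (λ e → Adj? (Near i) e v)} (e , a)))

  Near-new : ∀ i {v} → So (Near (suc i) v) → ¬ So (Near i v) → ∃ λ e → Adj (Near i) e v
  Near-new i near ¬near = [ ⊥-elim ∘ ¬near , toWitness ]′ (Equivalence.to T-∨ near)

  Stable : ℕ → Set
  Stable i = ∀ v → So (Near (suc i) v) → So (Near i v)

  Stable? : ∀ i → Dec (Stable i)
  Stable? i = FinP.all? λ v → T? (Near (suc i) v) →-dec T? (Near i v)

  grows : ∀ i → ¬ Stable i → ∃ λ v → So (Near (suc i) v) × ¬ So (Near i v)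
  grows i unstable with FinP.¬∀⟶∃¬ (nV H) _ (λ v → T? (Near (suc i) v) →-dec T? (Near i v)) unstable
  ... | v , ¬⇒ with T? (Near (suc i) v) | T? (Near i v)
  ...   | yes new | no  ¬old = v , new , ¬old
  ...   | _       | yes old  = ⊥-elim (¬⇒ λ _ → old)
  ...   | no ¬new | _        = ⊥-elim (¬⇒ λ new → ⊥-elim (¬new new))

  -- Each of the first nV H + 1 unstable rounds would reach a new vertex.
  stable : ∃ Stable
  stable with FinP.any? (λ (i : Fin (suc (nV H))) → Stable? (toℕ i))
  ... | yes (i , st) = toℕ i , st
  ... | no  none = ⊥-elim (1+n≰n (FinP.injective⇒≤ new-injective))
    where
    new : Fin (suc (nV H)) → Fin (nV H)
    new i = proj₁ (grows (toℕ i) (none ∘ (i ,_)))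
    new-later : ∀ a b → toℕ a < toℕ b → new a ≢ new b
    new-later a b a<b eq = proj₂ (proj₂ (grows (toℕ b) (none ∘ (b ,_))))
      (subst (So ∘ Near (toℕ b)) eq (Near-mono a<b (proj₁ (proj₂ (grows (toℕ a) (none ∘ (a ,_)))))))
    new-injective : Injective _≡_ _≡_ new
    new-injective {a} {b} eq with <-cmp (toℕ a) (toℕ b)
    ... | tri< a<b _ _ = ⊥-elim (new-later a b a<b eq)
    ... | tri≈ _ a≡b _ = FinP.toℕ-injective a≡b
    ... | tri> _ _ b<a = ⊥-elim (new-later b a b<a (sym eq))

  descent : ∀ N → (∀ v → So (Near N v)) → Descent H r
  descent N all-near = record { height = height ; down = down }
    where
    level : ∀ v → ∃ λ m → So (Near m v) × (∀ j → j < m → ¬ So (Near j v))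
    level v = first (λ j → T? (Near j v)) N (all-near v)
    height : Fin (nV H) → ℕ
    height = proj₁ ∘ level
    height≤ : ∀ {w} j → So (Near j w) → height w ≤ j
    height≤ {w} j near = ≮⇒≥ λ j< → proj₂ (proj₂ (level w)) j j< near
    down : ∀ v → v ≢ r → ∃ λ e → ∃ λ w → Joins H e v w × height w < height v
    down v v≢r with level v
    ... | zero  , near , _ = ⊥-elim (v≢r (toWitness near))
    ... | suc j , near , minimal with Near-new j near (minimal j ≤-refl)
    ...   | e , adj with Adj⇒Joins adj
    ...     | w , joins , near-w = e , w , joins , s≤s (height≤ j near-w)

  cut : ∀ N → Stable N → ∃ (λ v → ¬ So (Near N v)) → Cut H r
  cut N st (v , far) = record
    { side           = Near N
    ; root-side      = Equivalence.to T-≡ (Near-mono {j = N} z≤n (fromWitness {a? = r ≟ r} refl))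
    ; edge-side      = λ e → So-≡ (λ near → st _ (Near-adj N (inj₂ (refl , near))))
                                  (λ near → st _ (Near-adj N (inj₁ (refl , near))))
    ; outside-vertex = v , ¬So⇒≡false far
    }

  search : Descent H r ⊎ Cut H r
  search with stable
  ... | N , st with FinP.all? (λ v → T? (Near N v))
  ...   | yes all-near = inj₁ (descent N all-near)
  ...   | no  ¬all     = inj₂ (cut N st (FinP.¬∀⟶∃¬ (nV H) _ (λ v → T? (Near N v)) ¬all))

-- Contracting the tree edge between t and its parent p: the vertices of Fin (suc k) other than t
-- are renumbered into Fin k by punchOut, and t is sent where p is.
module Contract {k} (T : RootedTree (suc k)) (t : Fin (suc k)) (t≢p : t ≢ parent T t) where

  private
    p : Fin (suc k)
    p = parent T t

  retarget : Fin (suc k) → Fin (suc k)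
  retarget v with v ≟ t
  ... | yes _ = p
  ... | no  _ = v

  t≢retarget : ∀ v → t ≢ retarget v
  t≢retarget v with v ≟ t
  ... | yes _   = t≢p
  ... | no  v≢t = v≢t ∘ sym

  retarget-t : retarget t ≡ p
  retarget-t with t ≟ t
  ... | yes _   = refl
  ... | no  t≢t = ⊥-elim (t≢t refl)

  retarget-≢ : ∀ {v} → v ≢ t → retarget v ≡ v
  retarget-≢ {v} v≢t with v ≟ t
  ... | yes v≡t = ⊥-elim (v≢t v≡t)
  ... | no  _   = refl

  collapse : Fin (suc k) → Fin k
  collapse v = punchOut (t≢retarget v)

  punchIn-collapse : ∀ v → punchIn t (collapse v) ≡ retarget v
  punchIn-collapse v = FinP.punchIn-punchOut (t≢retarget v)

  collapse-injective′ : ∀ {a b} → collapse a ≡ collapse b → retarget a ≡ retarget b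
  collapse-injective′ {a} {b} = FinP.punchOut-injective (t≢retarget a) (t≢retarget b)

  collapse-punchIn : ∀ x → collapse (punchIn t x) ≡ x
  collapse-punchIn x =
    trans (FinP.punchOut-cong t (retarget-≢ (FinP.punchInᵢ≢i t x))) (FinP.punchOut-punchIn t)

  collapse-t : collapse t ≡ collapse p
  collapse-t = FinP.punchOut-cong t (trans retarget-t (sym (retarget-≢ (t≢p ∘ sym))))

  collapse-injective : ∀ {a b} → collapse a ≡ collapse b → collapse a ≢ collapse p → a ≡ b
  collapse-injective {a} {b} eq a≉p = begin
    a          ≡⟨ retarget-≢ a≢t ⟨
    retarget a ≡⟨ collapse-injective′ {a} {b} eq ⟩
    retarget b ≡⟨ retarget-≢ b≢t ⟩
    b          ∎
    where
    open ≡-Reasoning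
    a≢t : a ≢ t
    a≢t refl = a≉p collapse-t
    b≢t : b ≢ t
    b≢t refl = a≉p (trans eq collapse-t)

  parent′ : Fin k → Fin k
  parent′ x = collapse (parent T (punchIn t x))

  parent′-collapse : ∀ z → z ≢ t → parent′ (collapse z) ≡ collapse (parent T z)
  parent′-collapse z z≢t = cong (collapse ∘ parent T) (trans (punchIn-collapse z) (retarget-≢ z≢t))

  parent′-collapse-t : parent′ (collapse t) ≡ collapse (parent T p)
  parent′-collapse-t = cong (collapse ∘ parent T) (trans (punchIn-collapse t) retarget-t)

  step-up : ∀ z → Dec (z ≡ t) → ∃ λ n → parent′ (collapse z) ≡ collapse (iter (parent T) (suc n) z)
  step-up z (no  z≢t) = 0 , parent′-collapse z z≢t
  step-up z (yes refl) = 1 , parent′-collapse-t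

  step-up⁻ : ∀ z → Dec (z ≡ t) → ∃ λ n → iter parent′ n (collapse z) ≡ collapse (parent T z)
  step-up⁻ z (no  z≢t) = 1 , parent′-collapse z z≢t
  step-up⁻ z (yes refl) = 0 , collapse-t

  -- The contracted path from collapse y skips at most the step from t to p.
  iter-parent′ : ∀ j y → ∃ λ j′ → j ≤ j′ × iter parent′ j (collapse y) ≡ collapse (iter (parent T) j′ y)
  iter-parent′ zero    y = 0 , z≤n , refl
  iter-parent′ (suc j) y with iter-parent′ j y
  ... | j′ , j≤j′ , eq with step-up (iter (parent T) j′ y) (iter (parent T) j′ y ≟ t)
  ...   | n , up = suc n + j′ , s≤s (≤-trans j≤j′ (m≤n+m j′ n)) , (begin
    parent′ (iter parent′ j (collapse y))              ≡⟨ cong parent′ eq ⟩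
    parent′ (collapse (iter (parent T) j′ y))          ≡⟨ up ⟩
    collapse (iter (parent T) (suc n) (iter (parent T) j′ y)) ≡⟨ cong collapse (iter-+ (parent T) (suc n) j′ y) ⟨
    collapse (iter (parent T) (suc n + j′) y)          ∎)
    where open ≡-Reasoning

  iter-parent⁻ : ∀ j y → ∃ λ j′ → iter parent′ j′ (collapse y) ≡ collapse (iter (parent T) j y)
  iter-parent⁻ zero    y = 0 , refl
  iter-parent⁻ (suc j) y with iter-parent⁻ j y
  ... | j′ , eq with step-up⁻ (iter (parent T) j y) (iter (parent T) j y ≟ t)
  ...   | n , up = n + j′ , trans (iter-+ parent′ n j′ (collapse y)) (trans (cong (iter parent′ n) eq) up)

  reaches′ : ∀ x j → iter (parent T) j (punchIn t x) ≡ root T → iter parent′ j x ≡ collapse (root T)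
  reaches′ x j reached with iter-parent′ j (punchIn t x)
  ... | j′ , j≤j′ , eq = begin
    iter parent′ j x                              ≡⟨ cong (iter parent′ j) (collapse-punchIn x) ⟨
    iter parent′ j (collapse (punchIn t x))       ≡⟨ eq ⟩
    collapse (iter (parent T) j′ (punchIn t x))   ≡⟨ cong collapse (iter-beyond (parent T) j reached (parent-root T) j′ j≤j′) ⟩
    collapse (root T)                             ∎
    where open ≡-Reasoning

  root≢t : root T ≢ t
  root≢t r≡t = t≢p (trans (sym r≡t) (trans (sym (parent-root T)) (cong (parent T) r≡t)))

  contracted : RootedTree k
  contracted = record
    { root        = collapse (root T)
    ; parent      = parent′
    ; parent-root = trans (parent′-collapse (root T) root≢t) (cong collapse (parent-root T))
    ; reaches     = λ x → let (j , reached) = reaches T (punchIn t x) in j , reaches′ x j reached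
    }

  contracted-depth : ∀ {d} → DepthAtMost T d → DepthAtMost contracted d
  contracted-depth {d} depth x = reaches′ x d (depth (punchIn t x))

  collapse-ancestor : ∀ {u w} → AncestorOrEq T u w → AncestorOrEq contracted (collapse u) (collapse w)
  collapse-ancestor {w = w} (j , reached) with iter-parent⁻ j w
  ... | j′ , eq = j′ , trans eq (cong collapse reached)

  -- Contracting creates no cycle when t and its parent lie on different sides of a cut.
  module _ (G : Graph) (φ : Fin (nV G) → Fin (suc k)) (side : Fin (suc k) → Bool)
           (edge-side : ∀ e → side (φ (proj₁ (ends G e))) ≡ side (φ (proj₂ (ends G e))))
           (side-t : side t ≡ false) (side-p : side (parent T t) ≡ true) where

    private
      H H′ : Graph
      H  = mapVertices G φ
      H′ = mapVertices G (collapse ∘ φ)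

    sideₑ : Fin (nE G) → Bool
    sideₑ e = side (φ (proj₁ (ends G e)))

    ends-side : ∀ {e x y} → Joins H e x y → side x ≡ sideₑ e × side y ≡ sideₑ e
    ends-side {e} (inj₁ (a , b)) = cong side (sym a) , trans (cong side (sym b)) (sym (edge-side e))
    ends-side {e} (inj₂ (a , b)) = trans (cong side (sym b)) (sym (edge-side e)) , cong side (sym a)

    same-side : ∀ {e e′ u v w} → Joins H′ e u v → Joins H′ e′ v w → v ≢ collapse p → sideₑ e ≡ sideₑ e′
    same-side J J′ v≢p with Joins-map-∘⁻ G φ collapse J | Joins-map-∘⁻ G φ collapse J′
    ... | _ , y , Jxy , _ , y↦v | x′ , _ , Jx′y′ , x′↦v , _ =
      trans (sym (proj₂ (ends-side Jxy)))
            (trans (cong side (collapse-injective (trans y↦v (sym x′↦v)) (v≢p ∘ trans (sym y↦v))))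
                   (proj₁ (ends-side Jx′y′)))

    lift-cycle : ∀ {F} → Cycleℕ H′ F → Cycleℕ H F
    lift-cycle {F} c = record
      { len = len ; edge = edge ; vert = lift ∘ vert ; closed = cong lift closed ; edge-inj = edge-inj
      ; vert-inj = λ a b a≤ b≤ eq → vert-inj a b a≤ b≤ (trans (sym (collapse-lift _)) (trans (cong collapse eq) (collapse-lift _)))
      ; joins = lifted-joins ; inF = inF
      }
      where
      open Cycleℕ c
      s : Bool
      s = sideₑ (edge 0)

      -- the merged vertex occurs at most once on the cycle, so the side can change at most there
      cycle-side : ∀ j → j ≤ len → sideₑ (edge j) ≡ s
      cycle-side with position vert len vert-inj (collapse p)
      ... | q , at-q = constant-around (sideₑ ∘ edge) len q step wrap
        where
        step : ∀ j → j < len → suc j ≢ q → sideₑ (edge (suc j)) ≡ sideₑ (edge j)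
        step j j<len sj≢q = sym (same-side (joins j (<⇒≤ j<len)) (joins (suc j) j<len) (sj≢q ∘ at-q (suc j) j<len))
        wrap : q ≢ 0 → sideₑ (edge len) ≡ sideₑ (edge 0)
        wrap q≢0 = same-side (joins len ≤-refl) (subst (λ u → Joins H′ (edge 0) u (vert 1)) closed (joins 0 z≤n))
                             (λ eq → q≢0 (sym (at-q 0 z≤n (trans closed eq))))

      lift′ : (y : Fin (suc k)) → Dec (y ≡ p) → Fin (suc k)
      lift′ y (yes _) = if s then p else t
      lift′ y (no  _) = y

      lift : Fin k → Fin (suc k)
      lift w = lift′ (punchIn t w) (punchIn t w ≟ p)

      collapse-lift : ∀ w → collapse (lift w) ≡ w
      collapse-lift w = undo (punchIn t w ≟ p)
        where
        undo : (d : Dec (punchIn t w ≡ p)) → collapse (lift′ (punchIn t w) d) ≡ w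
        undo (no  _)  = collapse-punchIn w
        undo (yes eq) = trans (choice s) (trans (cong collapse (sym eq)) (collapse-punchIn w))
          where
          choice : ∀ b → collapse (if b then p else t) ≡ collapse p
          choice true  = refl
          choice false = collapse-t

      lift-collapse : ∀ x → side x ≡ s → lift (collapse x) ≡ x
      lift-collapse x x-side = redo (punchIn t (collapse x)) (punchIn-collapse x) (_ ≟ p) (x ≟ t)
        where
        redo : ∀ y → y ≡ retarget x → (d : Dec (y ≡ p)) → Dec (x ≡ t) → lift′ y d ≡ x
        redo y _    (yes _)   (yes refl) = cong (if_then p else t) (trans (sym x-side) side-t)
        redo y y≡rx (yes y≡p) (no  x≢t)  = trans (cong (if_then p else t) (trans (sym x-side) (trans (cong side x≡p) side-p)))
                                                 (sym x≡p)
          where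
          x≡p : x ≡ p
          x≡p = trans (sym (retarget-≢ x≢t)) (trans (sym y≡rx) y≡p)
        redo y y≡rx (no  y≢p) (yes refl) = ⊥-elim (y≢p (trans y≡rx retarget-t))
        redo y y≡rx (no  _)   (no  x≢t)  = trans y≡rx (retarget-≢ x≢t)

      lifted-joins : ∀ j → j ≤ len → Joins H (edge j) (lift (vert j)) (lift (vert (suc j)))
      lifted-joins j j≤ with Joins-map-∘⁻ G φ collapse (joins j j≤)
      ... | x , y , Jxy , x↦ , y↦ = subst₂ (Joins H (edge j)) (lifts x x↦ (proj₁ (ends-side Jxy)))
                                                              (lifts y y↦ (proj₂ (ends-side Jxy))) Jxy
        where
        lifts : ∀ z {v} → collapse z ≡ v → side z ≡ sideₑ (edge j) → z ≡ lift v
        lifts z refl z-side = sym (lift-collapse z (trans z-side (cycle-side j j≤)))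

-- Depth-decompositions from tree models

record TreeModel (G : Graph) (d k : ℕ) : Set where
  field
    tree          : RootedTree k
    depth         : DepthAtMost tree d
    place         : Fin (nV G) → Fin k
    comparable    : ∀ e → Comparable tree (place (proj₁ (ends G e))) (place (proj₂ (ends G e)))
    reflect-cycle : ∀ {F} → Cycleℕ (mapVertices G place) F → Cycleℕ G F

TreeDepthAtMost⇒TreeModel : ∀ {G d} → TreeDepthAtMost G d → TreeModel G d (nV G)
TreeDepthAtMost⇒TreeModel (T , in-closure , depth) = record
  { tree = T ; depth = depth ; place = id ; comparable = in-closure ; reflect-cycle = id }

-- Climbing from a vertex outside the cut to the root crosses the cut along some tree edge; contract it.
contract-model : ∀ {G d k} (M : TreeModel G d (suc k)) →
                 Cut (mapVertices G (TreeModel.place M)) (root (TreeModel.tree M)) → TreeModel G d k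
contract-model {G} {d} {k} M cut = model (crossing (parent tree) side v₀ j (proj₂ outside-vertex) climbed)
  where
  open TreeModel M
  open Cut cut
  v₀ : Fin (suc k)
  v₀ = proj₁ outside-vertex
  j : ℕ
  j = proj₁ (reaches tree v₀)
  climbed : side (iter (parent tree) j v₀) ≡ true
  climbed = trans (cong side (proj₂ (reaches tree v₀))) root-side
  model : (∃ λ t → side t ≡ false × side (parent tree t) ≡ true) → TreeModel G d k
  model (t , side-t , side-p) = record
    { tree          = contracted
    ; depth         = contracted-depth {d} depth
    ; place         = collapse ∘ place
    ; comparable    = Sum.map collapse-ancestor collapse-ancestor ∘ comparable
    ; reflect-cycle = reflect-cycle ∘ lift-cycle G place side edge-side side-t side-p
    }
    where
    t≢p : t ≢ parent tree t
    t≢p t≡p with trans (sym side-t) (trans (cong side t≡p) side-p)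
    ... | ()
    open Contract tree t t≢p

-- The edges from the non-root vertices down to lower ones form a spanning tree of the drawing of G.
module Connected {G d k} (M : TreeModel G d k)
                 (D : Descent (mapVertices G (TreeModel.place M)) (root (TreeModel.tree M))) where
  open TreeModel M
  open Descent D

  private
    H : Graph
    H = mapVertices G place
    r : Fin k
    r = root tree

  down-edge : Fin k → Maybe (Fin (nE G))
  down-edge v with v ≟ r
  ... | yes _   = nothing
  ... | no  v≢r = just (proj₁ (down v v≢r))

  down-edge-spec : ∀ v {e} → down-edge v ≡ just e → ∃ λ w → Joins H e v w × height w < height v
  down-edge-spec v with v ≟ r
  ... | yes _   = λ ()
  ... | no  v≢r = λ { refl → proj₂ (down v v≢r) }

  down-edge-defined : ∀ v → v ≢ r → ∃ λ e → down-edge v ≡ just e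
  down-edge-defined v v≢r with v ≟ r
  ... | yes v≡r = ⊥-elim (v≢r v≡r)
  ... | no  _   = _ , refl

  down-edge-injective : ∀ {x y e} → down-edge x ≡ just e → down-edge y ≡ just e → x ≡ y
  down-edge-injective {x} {y} {e} x↦e y↦e with down-edge-spec x x↦e | down-edge-spec y y↦e
  ... | wx , Jx , wx<x | wy , Jy , wy<y with Joins-ends H e Jx Jy
  ... | inj₁ (x≡y , _)      = x≡y
  ... | inj₂ (x≡wy , wx≡y) =
    ⊥-elim (<-asym (subst (_< height x) (cong height wx≡y) wx<x) (subst (_< height y) (cong height (sym x≡wy)) wy<y))

  spanning : Subset (nE G)
  spanning = tabulate λ e → ⌊ FinP.any? (λ v → ≡-dec _≟_ (down-edge v) (just e)) ⌋

  ∈spanning⁺ : ∀ {v e} → down-edge v ≡ just e → e ∈ spanning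
  ∈spanning⁺ {v} {e} v↦e = ∈-tabulate⁺ _ (fromWitness {a? = FinP.any? (λ v → ≡-dec _≟_ (down-edge v) (just e))} (v , v↦e))

  ∈spanning⁻ : ∀ {e} → e ∈ spanning → ∃ λ v → down-edge v ≡ just e
  ∈spanning⁻ e∈ = toWitness (∈-tabulate⁻ _ e∈)

  spanning-acyclic : ¬ Cycleℕ G spanning
  spanning-acyclic = descent⇒noCycle G spanning (height ∘ place) (down-edge ∘ place) downhill
    where
    downhill : ∀ e u w → e ∈ spanning → Joins G e u w → height (place w) ≤ height (place u) →
               height (place w) < height (place u) × down-edge (place u) ≡ just e
    downhill e u w e∈ Juw w≤u with ∈spanning⁻ e∈
    ... | v , v↦e with down-edge-spec v v↦e
    ...   | w′ , Jvw′ , w′<v with Joins-ends H e (Joins-map G place Juw) Jvw′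
    ...     | inj₁ (u≡v , w≡w′) = subst₂ _<_ (cong height (sym w≡w′)) (cong height (sym u≡v)) w′<v ,
                                  trans (cong down-edge u≡v) v↦e
    ...     | inj₂ (u≡w′ , w≡v) = ⊥-elim (<⇒≱ w′<v (subst₂ _≤_ (cong height w≡v) (cong height u≡w′) w≤u))

  ends-bound : ∀ F → Acyclic G F → ∣ F ∣ ≤ ∣ endsExcept H r F ∣
  ends-bound F acyclic = forest-bound H r F (acyclic ∘ Cycleℕ⇒Cycle ∘ reflect-cycle)

  forest-size : ∀ F → Acyclic G F → ∣ F ∣ ≤ k ∸ 1
  forest-size F acyclic = ≤-trans (ends-bound F acyclic) (≤-trans (SubP.p⊆q⇒∣p∣≤∣q∣ ends⊆)
                                                                  (≤-reflexive (∣∁⁅x⁆∣≡n∸1 r)))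
    where
    ends⊆ : endsExcept H r F ⊆ ∁ ⁅ r ⁆
    ends⊆ v∈ = ∈∁⁅⁆⁺ (proj₁ (∈endsExcept⁻ H r F v∈))

  ∣spanning∣ : ∣ spanning ∣ ≡ k ∸ 1
  ∣spanning∣ = ≤-antisym (forest-size spanning (spanning-acyclic ∘ Cycle⇒Cycleℕ)) (begin
    k ∸ 1         ≡⟨ ∣∁⁅x⁆∣≡n∸1 r ⟨
    ∣ ∁ ⁅ r ⁆ ∣   ≤⟨ injection⇒∣p∣≤∣q∣ (∁ ⁅ r ⁆) spanning edge-of (λ v v∈ → ∈spanning⁺ (proj₂ (defined v v∈)))
                       (λ x y x∈ y∈ eq → down-edge-injective (proj₂ (defined x x∈))
                                            (subst (λ e → down-edge y ≡ just e) (sym eq) (proj₂ (defined y y∈)))) ⟩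
    ∣ spanning ∣  ∎)
    where
    open ≤-Reasoning
    defined : ∀ v → v ∈ ∁ ⁅ r ⁆ → ∃ λ e → down-edge v ≡ just e
    defined v v∈ = down-edge-defined v (∈∁⁅⁆⁻ v∈)
    edge-of : ∀ v → v ∈ ∁ ⁅ r ⁆ → Fin (nE G)
    edge-of v v∈ = proj₁ (defined v v∈)

  f : Fin (nE G) → Fin k
  f e = lower tree (comparable e)

  ends-below-f : ∀ e {v} → Incident H e v → AncestorOrEq tree v (f e)
  ends-below-f e (inj₁ refl) = proj₁ (lower-below tree (comparable e))
  ends-below-f e (inj₂ refl) = proj₂ (lower-below tree (comparable e))

  rank-bound : ∀ X ρ → IsRank G X ρ → ρ ≤ ‖T*‖ tree f X
  rank-bound X ρ ((F , F⊆X , acyclic , ∣F∣≡ρ) , _) =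
    subst (_≤ ‖T*‖ tree f X) ∣F∣≡ρ (≤-trans (ends-bound F acyclic) (SubP.p⊆q⇒∣p∣≤∣q∣ ends⊆))
    where
    ends⊆ : endsExcept H r F ⊆ T*-vertices tree f X
    ends⊆ v∈ with ∈endsExcept⁻ H r F v∈
    ... | v≢r , e , e∈F , v∈e = ∈T*-vertices⁺ tree f v≢r (F⊆X e∈F) (ends-below-f e v∈e)

  rank-⊤ : IsRank G ⊤ ‖ tree ‖
  rank-⊤ = (spanning , (λ _ → SubP.∈⊤) , spanning-acyclic ∘ Cycle⇒Cycleℕ , ∣spanning∣) ,
           λ F _ → forest-size F

  decomposition : BranchDepthAtMost G d
  decomposition = k , tree , f , (rank-⊤ , rank-bound) , depth

decompose : ∀ {G d} k → TreeModel G d k → BranchDepthAtMost G d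
decompose zero M = ⊥-elim (FinP.¬Fin0 (root (TreeModel.tree M)))
decompose {G} (suc k) M = [ Connected.decomposition M , decompose k ∘ contract-model M ]′
  (BreadthFirst.search (mapVertices G (TreeModel.place M)) (root (TreeModel.tree M)))

proposition11 : (G : Graph) (d : ℕ) → TreeDepthAtMost G d → BranchDepthAtMost G d
proposition11 G d td = decompose (nV G) (TreeDepthAtMost⇒TreeModel {G} {d} td)
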